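{- For any non-negative integer $N$, as formal power series in independent variables $q,a,b,t$, \[ \sum_{k\geq 0 }\frac{(bt)^kq^{k(k+1)/2}}{(atq;q)_k} {N\brack k}_q \;=\; \sum_{m\geq 0} (bt)^mq^{m(m+1)/2}\,(-btq^{m+1};q)_{N-m}\, \frac{(at)^mq^{m^2}}{(atq;q)_m} {N\brack m}_q. \]
   Context: For $n\in\mathbb{Z}_{\ge0}$, $(c;q)_n=\prod_{i=0}^{n-1}(1-cq^i)$. The Gaussian coefficient is ${a+b\brack b}_q=\frac{(q;q)_{a+b}}{(q;q)_a(q;q)_b}$ if $a,b\ge 0$ are integers and $0$ otherwise; in particular all terms with $k>N$ or $m>N$ vanish. -}

module Defs where

open import Level using (Level)
open import Algebra.Bundles using (CommutativeRing)
open import Data.Nat as ℕ using (ℕ; zero; suc; _≤?_; _∸_; ⌊_/2⌋)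
open import Relation.Nullary using (yes; no)

-- Everything is stated over an arbitrary commutative ring R containing
-- elements q a b t, together with chosen inverses of the factors
-- (1 - q^(i+1)) and (1 - a t q^(i+1)) that occur in denominators.
module QSeries {c ℓ : Level} (R : CommutativeRing c ℓ) where
  open CommutativeRing R

  pow : Carrier → ℕ → Carrier
  pow x zero    = 1#
  pow x (suc n) = x * pow x n

  prod : ℕ → (ℕ → Carrier) → Carrier
  prod zero    f = 1#
  prod (suc n) f = prod n f * f n

  sumTo : ℕ → (ℕ → Carrier) → Carrier
  sumTo zero    f = f 0
  sumTo (suc n) f = sumTo n f + f (suc n)

  poch : Carrier → Carrier → ℕ → Carrier
  poch x q n = prod n (λ i → 1# + - (x * pow q i))

  tri : ℕ → ℕ
  tri k = ⌊ k ℕ.* suc k /2⌋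

  -- inverse of (q;q)_n, built from chosen inverses iq i of (1 - q^(i+1))
  invQQ : (ℕ → Carrier) → ℕ → Carrier
  invQQ iq n = prod n iq

  qbinom : Carrier → (ℕ → Carrier) → ℕ → ℕ → Carrier
  qbinom q iq N k with k ≤? N
  ... | yes _ = poch q q N * invQQ iq k * invQQ iq (N ∸ k)
  ... | no  _ = 0#

-- Write [N, k] for the Gaussian coefficient, T_N(x, d) = Σ_k x^k q^(k(k+1)/2) d_k [N, k] and
-- P_N(x, c) = Σ_m x^m q^(m(m+1)/2) (-x q^(m+1); q)_(N-m) c_m [N, m].
-- The q-Pascal rule [N+1, m+1] = q^(m+1) [N, m+1] + [N, m] turns a sum over [N+1, m]
-- into a sum over [N, m] of the shifted sequence q^m c_m + c_(m+1).  From it one gets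
-- (1) Σ_m [k, m] y^m q^(m²) / (yq; q)_m = 1 / (yq; q)_k, by induction on k, because the
--     shifted sequence is the same kind of sequence for (yq) and an extra factor 1/(1 - yq);
-- (2) T_N(x, B c) = P_N(x, c), where (B c)_k = Σ_m [k, m] c_m, by induction on N, because
--     both sides satisfy S_(N+1)(x, c) = S_N(xq, c) + xq S_N(xq, shifted c).
-- The theorem is (2) with x = bt applied to the sequence of (1) with y = at.
module Submission where

open import Defs
open import Level using (Level)
open import Algebra.Bundles using (CommutativeRing)
open import Data.Nat using (ℕ; suc; _∸_)
open import Data.Nat as ℕ using (zero; _≤_; _<_; z≤n; s≤s; _≤?_; ⌊_/2⌋)
import Data.Nat.Properties as ℕₚ
open import Data.Nat.Tactic.RingSolver using (solve-∀)
open import Function using (_∘_)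
open import Relation.Nullary using (yes; no)
open import Relation.Binary.PropositionalEquality as ≡ using (_≡_)
open import Relation.Binary.Definitions using (tri<; tri≈; tri>)
open import Data.Empty using (⊥-elim)

⌊m+m+n/2⌋≡m+⌊n/2⌋ : ∀ m n → ⌊ (m ℕ.+ m) ℕ.+ n /2⌋ ≡ m ℕ.+ ⌊ n /2⌋
⌊m+m+n/2⌋≡m+⌊n/2⌋ zero    n = ≡.refl
⌊m+m+n/2⌋≡m+⌊n/2⌋ (suc m) n =
  ≡.trans (≡.cong (λ k → ⌊ suc k ℕ.+ n /2⌋) (ℕₚ.+-suc m m)) (≡.cong suc (⌊m+m+n/2⌋≡m+⌊n/2⌋ m n))

[1+m][2+m]≡[1+m]+[1+m]+m[1+m] : ∀ m → suc m ℕ.* suc (suc m) ≡ (suc m ℕ.+ suc m) ℕ.+ m ℕ.* suc m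
[1+m][2+m]≡[1+m]+[1+m]+m[1+m] = solve-∀

[1+m]²≡m²+m+[1+m] : ∀ m → suc m ℕ.* suc m ≡ (m ℕ.* m ℕ.+ m) ℕ.+ suc m
[1+m]²≡m²+m+[1+m] = solve-∀

module Properties {c ℓ : Level} (R : CommutativeRing c ℓ) where
  open CommutativeRing R
  open QSeries R
  open import Algebra.Properties.Ring ring using (-‿distribˡ-*; -‿distribʳ-*; -‿involutive)
  open import Algebra.Solver.Ring.NaturalCoefficients.Default commutativeSemiring
  open import Relation.Binary.Reasoning.Setoid setoid

  tri-suc : ∀ k → tri (suc k) ≡ suc k ℕ.+ tri k
  tri-suc k = ≡.trans (≡.cong ⌊_/2⌋ ([1+m][2+m]≡[1+m]+[1+m]+m[1+m] k)) (⌊m+m+n/2⌋≡m+⌊n/2⌋ (suc k) _)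

  pow-+ : ∀ x m n → pow x (m ℕ.+ n) ≈ pow x m * pow x n
  pow-+ x zero    n = sym (*-identityˡ _)
  pow-+ x (suc m) n = trans (*-congˡ (pow-+ x m n)) (sym (*-assoc _ _ _))

  pow-* : ∀ x y n → pow (x * y) n ≈ pow x n * pow y n
  pow-* x y zero    = sym (*-identityˡ _)
  pow-* x y (suc n) = trans (*-congˡ (pow-* x y n))
    (solve 4 (λ x y a b → (x :* y) :* (a :* b) := (x :* a) :* (y :* b)) refl x y (pow x n) (pow y n))

  pow-tri-suc : ∀ x k → pow x (tri (suc k)) ≈ pow x (suc k) * pow x (tri k)
  pow-tri-suc x k = trans (reflexive (≡.cong (pow x) (tri-suc k))) (pow-+ x (suc k) (tri k))

  pow-square-suc : ∀ x m → pow x (suc m ℕ.* suc m) ≈ pow x (m ℕ.* m) * pow x m * pow x (suc m)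
  pow-square-suc x m = begin
    pow x (suc m ℕ.* suc m)              ≈⟨ reflexive (≡.cong (pow x) ([1+m]²≡m²+m+[1+m] m)) ⟩
    pow x ((m ℕ.* m ℕ.+ m) ℕ.+ suc m)    ≈⟨ pow-+ x (m ℕ.* m ℕ.+ m) (suc m) ⟩
    pow x (m ℕ.* m ℕ.+ m) * pow x (suc m) ≈⟨ *-congʳ (pow-+ x (m ℕ.* m) m) ⟩
    pow x (m ℕ.* m) * pow x m * pow x (suc m) ∎

  prod-cong : ∀ n {f g} → (∀ i → f i ≈ g i) → prod n f ≈ prod n g
  prod-cong zero    f≈g = refl
  prod-cong (suc n) f≈g = *-cong (prod-cong n f≈g) (f≈g n)

  prod-suc-front : ∀ n f → prod (suc n) f ≈ f 0 * prod n (f ∘ suc)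
  prod-suc-front zero    f = trans (*-identityˡ _) (sym (*-identityʳ _))
  prod-suc-front (suc n) f = trans (*-congʳ (prod-suc-front n f)) (*-assoc _ _ _)

  sumTo-cong : ∀ n {f g} → (∀ i → i ≤ n → f i ≈ g i) → sumTo n f ≈ sumTo n g
  sumTo-cong zero    f≈g = f≈g 0 z≤n
  sumTo-cong (suc n) f≈g =
    +-cong (sumTo-cong n (λ i i≤n → f≈g i (ℕₚ.m≤n⇒m≤1+n i≤n))) (f≈g (suc n) ℕₚ.≤-refl)

  sumTo-+ : ∀ n f g → sumTo n (λ i → f i + g i) ≈ sumTo n f + sumTo n g
  sumTo-+ zero    f g = refl
  sumTo-+ (suc n) f g = trans (+-congʳ (sumTo-+ n f g))
    (solve 4 (λ a b c d → (a :+ b) :+ (c :+ d) := (a :+ c) :+ (b :+ d)) refl _ _ _ _)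

  sumTo-*ˡ : ∀ n a f → sumTo n (λ i → a * f i) ≈ a * sumTo n f
  sumTo-*ˡ zero    a f = refl
  sumTo-*ˡ (suc n) a f = trans (+-congʳ (sumTo-*ˡ n a f)) (sym (distribˡ _ _ _))

  sumTo-split : ∀ n w (f g h : ℕ → Carrier) →
    sumTo n (λ i → (f i + w * g i) * h i) ≈ sumTo n (λ i → f i * h i) + w * sumTo n (λ i → g i * h i)
  sumTo-split n w f g h = begin
    sumTo n (λ i → (f i + w * g i) * h i)
      ≈⟨ sumTo-cong n (λ i _ → trans (distribʳ _ _ _) (+-congˡ (*-assoc _ _ _))) ⟩
    sumTo n (λ i → f i * h i + w * (g i * h i))
      ≈⟨ trans (sumTo-+ n _ _) (+-congˡ (sumTo-*ˡ n w _)) ⟩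
    sumTo n (λ i → f i * h i) + w * sumTo n (λ i → g i * h i) ∎

  sumTo-suc-front : ∀ n f → sumTo (suc n) f ≈ f 0 + sumTo n (f ∘ suc)
  sumTo-suc-front zero    f = refl
  sumTo-suc-front (suc n) f = trans (+-congʳ (sumTo-suc-front n f)) (+-assoc _ _ _)

  sumTo-suc-vanishing : ∀ n f → f (suc n) ≈ 0# → sumTo (suc n) f ≈ sumTo n f
  sumTo-suc-vanishing n f f[1+n]≈0 = trans (+-congˡ f[1+n]≈0) (+-identityʳ _)

  1-xy≈x[1-y]+[1-x] : ∀ x y → 1# + - (x * y) ≈ x * (1# + - y) + (1# + - x)
  1-xy≈x[1-y]+[1-x] x y = begin
    1# + - (x * y)                        ≈⟨ sym (+-identityˡ _) ⟩
    0# + (1# + - (x * y))                 ≈⟨ +-congʳ (sym (-‿inverseʳ x)) ⟩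
    (x + - x) + (1# + - (x * y))          ≈⟨ solve 3 (λ x -x -xy → (x :+ -x) :+ (con 1 :+ -xy) := x :* con 1 :+ -xy :+ (con 1 :+ -x)) refl x (- x) (- (x * y)) ⟩
    (x * 1# + - (x * y)) + (1# + - x)     ≈⟨ +-congʳ (+-congˡ (-‿distribʳ-* x y)) ⟩
    (x * 1# + x * - y) + (1# + - x)       ≈⟨ +-congʳ (sym (distribˡ x 1# (- y))) ⟩
    x * (1# + - y) + (1# + - x)           ∎

  [1-z]w≈1⇒w≈1+zw : ∀ z w → (1# + - z) * w ≈ 1# → w ≈ 1# + z * w
  [1-z]w≈1⇒w≈1+zw z w [1-z]w≈1 = begin
    w                              ≈⟨ sym (+-identityʳ w) ⟩
    w + 0#                         ≈⟨ +-congˡ (sym (-‿inverseˡ (z * w))) ⟩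
    w + (- (z * w) + z * w)        ≈⟨ sym (+-assoc _ _ _) ⟩
    (w + - (z * w)) + z * w        ≈⟨ +-congʳ (+-congˡ (-‿distribˡ-* z w)) ⟩
    (w + - z * w) + z * w          ≈⟨ +-congʳ (trans (+-congʳ (sym (*-identityˡ w))) (sym (distribʳ w 1# (- z)))) ⟩
    (1# + - z) * w + z * w         ≈⟨ +-congʳ [1-z]w≈1 ⟩
    1# + z * w                     ∎

  poch-cong : ∀ {z z′} q n → z ≈ z′ → poch z q n ≈ poch z′ q n
  poch-cong q n z≈z′ = prod-cong n (λ i → +-congˡ (-‿cong (*-congʳ z≈z′)))

  poch-suc-front : ∀ z q n → poch z q (suc n) ≈ (1# + - z) * poch (z * q) q n
  poch-suc-front z q n = trans (prod-suc-front n _)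
    (*-cong (+-congˡ (-‿cong (*-identityʳ z)))
            (prod-cong n (λ i → +-congˡ (-‿cong (sym (*-assoc z q (pow q i)))))))

  IsPochInverse : Carrier → Carrier → (ℕ → Carrier) → Set ℓ
  IsPochInverse q y iy = ∀ i → (1# + - (y * pow q (suc i))) * iy i ≈ 1#

  module Gaussian (q : Carrier) (iq : ℕ → Carrier) (hq : ∀ i → (1# + - pow q (suc i)) * iq i ≈ 1#) where

    binom : ℕ → ℕ → Carrier
    binom = qbinom q iq

    poch-invQQ : ∀ n → poch q q n * invQQ iq n ≈ 1#
    poch-invQQ zero    = *-identityˡ _
    poch-invQQ (suc n) = begin
      poch q q n * u * (invQQ iq n * iq n)     ≈⟨ solve 4 (λ a b c d → (a :* b) :* (c :* d) := (a :* c) :* (b :* d)) refl _ u _ _ ⟩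
      poch q q n * invQQ iq n * (u * iq n)     ≈⟨ *-cong (poch-invQQ n) (hq n) ⟩
      1# * 1#                                  ≈⟨ *-identityˡ _ ⟩
      1#                                       ∎
      where u = 1# + - pow q (suc n)

    binom-≤ : ∀ {N k} → k ≤ N → binom N k ≈ poch q q N * invQQ iq k * invQQ iq (N ∸ k)
    binom-≤ {N} {k} k≤N with k ≤? N
    ... | yes _   = refl
    ... | no  k≰N = ⊥-elim (k≰N k≤N)

    binom-> : ∀ {N k} → N < k → binom N k ≈ 0#
    binom-> {N} {k} N<k with k ≤? N
    ... | yes k≤N = ⊥-elim (ℕₚ.<⇒≱ N<k k≤N)
    ... | no  _   = refl

    binom-0 : ∀ N → binom N 0 ≈ 1#
    binom-0 N = trans (binom-≤ {N} z≤n) (trans (*-congʳ (*-identityʳ _)) (poch-invQQ N))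

    binom-diag : ∀ N → binom N N ≈ 1#
    binom-diag N = begin
      binom N N                                     ≈⟨ binom-≤ {N} {N} ℕₚ.≤-refl ⟩
      poch q q N * invQQ iq N * invQQ iq (N ∸ N)    ≈⟨ *-congˡ (reflexive (≡.cong (invQQ iq) (ℕₚ.n∸n≡0 N))) ⟩
      poch q q N * invQQ iq N * 1#                  ≈⟨ trans (*-identityʳ _) (poch-invQQ N) ⟩
      1#                                            ∎

    binom-pascal : ∀ N k → binom (suc N) (suc k) ≈ pow q (suc k) * binom N (suc k) + binom N k
    binom-pascal N k with ℕₚ.<-cmp k N
    ... | tri< k<N _ _ = begin
      binom (suc N) (suc k)                  ≈⟨ binom-≤ (s≤s (ℕₚ.<⇒≤ k<N)) ⟩
      Q * u N * (I k * iq k) * I (N ∸ k)     ≈⟨ *-congˡ (reflexive (≡.cong I N∸k≡1+j)) ⟩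
      Q * u N * (I k * iq k) * (I j * iq j)  ≈⟨ *-congʳ (*-congʳ (*-congˡ u-split)) ⟩
      Q * (A * u j + u k) * (I k * iq k) * (I j * iq j)
        ≈⟨ solve 8 (λ Q A uj uk Ik ik Ij ij → Q :* (A :* uj :+ uk) :* (Ik :* ik) :* (Ij :* ij)
                     := A :* (Q :* (Ik :* ik) :* Ij) :* (uj :* ij) :+ Q :* Ik :* (Ij :* ij) :* (uk :* ik))
                   refl Q A (u j) (u k) (I k) (iq k) (I j) (iq j) ⟩
      A * (Q * I (suc k) * I j) * (u j * iq j) + Q * I k * I (suc j) * (u k * iq k)
        ≈⟨ +-cong (trans (*-congˡ (hq j)) (*-identityʳ _)) (trans (*-congˡ (hq k)) (*-identityʳ _)) ⟩
      A * (Q * I (suc k) * I j) + Q * I k * I (suc j)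
        ≈⟨ +-cong (*-congˡ (sym (binom-≤ k<N)))
                  (trans (*-congˡ (reflexive (≡.cong I (≡.sym N∸k≡1+j)))) (sym (binom-≤ (ℕₚ.<⇒≤ k<N)))) ⟩
      A * binom N (suc k) + binom N k        ∎
      where
        Q = poch q q N
        I = invQQ iq
        u = λ i → 1# + - pow q (suc i)
        A = pow q (suc k)
        j = N ∸ suc k
        N∸k≡1+j : N ∸ k ≡ suc j
        N∸k≡1+j = ℕₚ.+-∸-assoc 1 k<N
        N≡k+[1+j] : N ≡ k ℕ.+ suc j
        N≡k+[1+j] = ≡.sym (≡.trans (≡.cong (k ℕ.+_) (≡.sym N∸k≡1+j)) (ℕₚ.m+[n∸m]≡n (ℕₚ.<⇒≤ k<N)))
        u-split : u N ≈ A * u j + u k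
        u-split = trans (+-congˡ (-‿cong (trans (reflexive (≡.cong (pow q ∘ suc) N≡k+[1+j]))
                                                (pow-+ q (suc k) (suc j)))))
                        (1-xy≈x[1-y]+[1-x] A (pow q (suc j)))
    ... | tri≈ _ ≡.refl _ = begin
      binom (suc N) (suc N)                         ≈⟨ binom-diag (suc N) ⟩
      1#                                            ≈⟨ sym (+-identityˡ _) ⟩
      0# + 1#                                       ≈⟨ sym (+-cong (trans (*-congˡ (binom-> {N} {suc N} ℕₚ.≤-refl)) (zeroʳ _)) (binom-diag N)) ⟩
      pow q (suc N) * binom N (suc N) + binom N N   ∎
    ... | tri> _ _ N<k = begin
      binom (suc N) (suc k)                         ≈⟨ binom-> (s≤s N<k) ⟩
      0#                                            ≈⟨ sym (+-identityˡ _) ⟩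
      0# + 0#                                       ≈⟨ sym (+-cong (trans (*-congˡ (binom-> (ℕₚ.m<n⇒m<1+n N<k))) (zeroʳ _)) (binom-> N<k)) ⟩
      pow q (suc k) * binom N (suc k) + binom N k   ∎

    qShift : (ℕ → Carrier) → ℕ → Carrier
    qShift f m = pow q m * f m + f (suc m)

    sumTo-binom-suc : ∀ N f → sumTo (suc N) (λ m → f m * binom (suc N) m) ≈ sumTo N (λ m → qShift f m * binom N m)
    sumTo-binom-suc N f = begin
      sumTo (suc N) (λ m → f m * binom (suc N) m)
        ≈⟨ sumTo-suc-front N _ ⟩
      f 0 * binom (suc N) 0 + sumTo N (λ m → f (suc m) * binom (suc N) (suc m))
        ≈⟨ +-cong head (trans (sumTo-cong N (λ m _ → tail m)) (sumTo-+ N _ _)) ⟩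
      g 0 + (sumTo N (g ∘ suc) + sumTo N h)
        ≈⟨ sym (+-assoc _ _ _) ⟩
      (g 0 + sumTo N (g ∘ suc)) + sumTo N h
        ≈⟨ +-congʳ (trans (sym (sumTo-suc-front N g)) (sumTo-suc-vanishing N g (trans (*-congˡ (binom-> {N} {suc N} ℕₚ.≤-refl)) (zeroʳ _)))) ⟩
      sumTo N g + sumTo N h
        ≈⟨ sym (sumTo-+ N g h) ⟩
      sumTo N (λ m → g m + h m)
        ≈⟨ sumTo-cong N (λ m _ → sym (distribʳ _ _ _)) ⟩
      sumTo N (λ m → qShift f m * binom N m) ∎
      where
        g h : ℕ → Carrier
        g m = pow q m * f m * binom N m
        h m = f (suc m) * binom N m
        head : f 0 * binom (suc N) 0 ≈ g 0
        head = *-cong (sym (*-identityˡ _)) (trans (binom-0 (suc N)) (sym (binom-0 N)))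
        tail : ∀ m → f (suc m) * binom (suc N) (suc m) ≈ g (suc m) + h m
        tail m = trans (*-congˡ (binom-pascal N m))
                       (trans (distribˡ _ _ _)
                              (+-congʳ (solve 3 (λ f A b → f :* (A :* b) := A :* f :* b) refl (f (suc m)) (pow q (suc m)) (binom N (suc m)))))

    binomialTransform : (ℕ → Carrier) → ℕ → Carrier
    binomialTransform c k = sumTo k (λ m → c m * binom k m)

    squareTerm : Carrier → (ℕ → Carrier) → ℕ → Carrier
    squareTerm y iy m = pow y m * pow q (m ℕ.* m) * prod m iy

    qShift-squareTerm : ∀ y iy → IsPochInverse q y iy → ∀ m →
      qShift (squareTerm y iy) m ≈ iy 0 * squareTerm (y * q) (iy ∘ suc) m
    qShift-squareTerm y iy hy m = begin
      Q * (Y * M * P) + y * Y * pow q (suc m ℕ.* suc m) * (P * iy m)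
        ≈⟨ +-congˡ (*-congʳ (*-congˡ (pow-square-suc q m))) ⟩
      Q * (Y * M * P) + y * Y * (M * Q * (q * Q)) * (P * iy m)
        ≈⟨ solve 7 (λ y q Y Q M P w → Q :* (Y :* M :* P) :+ y :* Y :* (M :* Q :* (q :* Q)) :* (P :* w)
                     := Y :* Q :* M :* P :* (con 1 :+ y :* (q :* Q) :* w))
                   refl y q Y Q M P (iy m) ⟩
      Y * Q * M * P * (1# + y * pow q (suc m) * iy m)
        ≈⟨ *-congˡ (sym ([1-z]w≈1⇒w≈1+zw _ _ (hy m))) ⟩
      Y * Q * M * P * iy m
        ≈⟨ solve 5 (λ Y Q M P w → Y :* Q :* M :* P :* w := Y :* Q :* M :* (P :* w)) refl Y Q M P (iy m) ⟩
      Y * Q * M * prod (suc m) iy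
        ≈⟨ *-cong (*-congʳ (sym (pow-* y q m))) (prod-suc-front m iy) ⟩
      pow (y * q) m * M * (iy 0 * prod m (iy ∘ suc))
        ≈⟨ solve 4 (λ a b c d → a :* b :* (c :* d) := c :* (a :* b :* d)) refl _ M (iy 0) _ ⟩
      iy 0 * squareTerm (y * q) (iy ∘ suc) m ∎
      where
        Y = pow y m
        Q = pow q m
        M = pow q (m ℕ.* m)
        P = prod m iy

    binomialTransform-squareTerm : ∀ k y iy → IsPochInverse q y iy → binomialTransform (squareTerm y iy) k ≈ prod k iy
    binomialTransform-squareTerm zero y iy hy =
      trans (*-cong (trans (*-identityʳ _) (*-identityʳ _)) (binom-0 0)) (*-identityʳ _)
    binomialTransform-squareTerm (suc k) y iy hy = begin
      binomialTransform (squareTerm y iy) (suc k)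
        ≈⟨ sumTo-binom-suc k _ ⟩
      sumTo k (λ m → qShift (squareTerm y iy) m * binom k m)
        ≈⟨ sumTo-cong k (λ m _ → trans (*-congʳ (qShift-squareTerm y iy hy m)) (*-assoc _ _ _)) ⟩
      sumTo k (λ m → iy 0 * (squareTerm (y * q) (iy ∘ suc) m * binom k m))
        ≈⟨ sumTo-*ˡ k _ _ ⟩
      iy 0 * binomialTransform (squareTerm (y * q) (iy ∘ suc)) k
        ≈⟨ *-congˡ (binomialTransform-squareTerm k (y * q) (iy ∘ suc) hyq) ⟩
      iy 0 * prod k (iy ∘ suc)
        ≈⟨ sym (prod-suc-front k iy) ⟩
      prod (suc k) iy ∎
      where
        hyq : IsPochInverse q (y * q) (iy ∘ suc)
        hyq i = trans (*-congʳ (+-congˡ (-‿cong (*-assoc _ _ _)))) (hy (suc i))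

    triSum : ℕ → Carrier → (ℕ → Carrier) → Carrier
    triSum N x d = sumTo N (λ k → pow x k * pow q (tri k) * d k * binom N k)

    tailPoch : Carrier → ℕ → ℕ → Carrier
    tailPoch x m n = poch (- (x * pow q (suc m))) q n

    pochTriSum : ℕ → Carrier → (ℕ → Carrier) → Carrier
    pochTriSum N x c = sumTo N (λ m → pow x m * pow q (tri m) * tailPoch x m (N ∸ m) * c m * binom N m)

    triSum-cong : ∀ N x {d d′} → (∀ k → d k ≈ d′ k) → triSum N x d ≈ triSum N x d′
    triSum-cong N x d≈d′ = sumTo-cong N (λ k _ → *-congʳ (*-congˡ (d≈d′ k)))

    triSum-suc : ∀ N x d → triSum (suc N) x d ≈ triSum N (x * q) d + x * q * triSum N (x * q) (d ∘ suc)
    triSum-suc N x d = begin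
      triSum (suc N) x d
        ≈⟨ sumTo-binom-suc N _ ⟩
      sumTo N (λ k → qShift (λ k → pow x k * pow q (tri k) * d k) k * binom N k)
        ≈⟨ sumTo-cong N (λ k _ → *-congʳ (term k)) ⟩
      sumTo N (λ k → (G k + x * q * H k) * binom N k)
        ≈⟨ sumTo-split N (x * q) G H (binom N) ⟩
      triSum N (x * q) d + x * q * triSum N (x * q) (d ∘ suc) ∎
      where
        G H : ℕ → Carrier
        G k = pow (x * q) k * pow q (tri k) * d k
        H k = pow (x * q) k * pow q (tri k) * d (suc k)
        term : ∀ k → pow q k * (pow x k * pow q (tri k) * d k) + x * pow x k * pow q (tri (suc k)) * d (suc k)
                     ≈ G k + x * q * H k
        term k = begin
          Q * (X * T * d k) + x * X * pow q (tri (suc k)) * d (suc k)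
            ≈⟨ +-congˡ (*-congʳ (*-congˡ (pow-tri-suc q k))) ⟩
          Q * (X * T * d k) + x * X * (q * Q * T) * d (suc k)
            ≈⟨ solve 7 (λ x q X Q T d d′ → Q :* (X :* T :* d) :+ x :* X :* (q :* Q :* T) :* d′
                         := X :* Q :* T :* d :+ x :* q :* (X :* Q :* T :* d′))
                       refl x q X Q T (d k) (d (suc k)) ⟩
          X * Q * T * d k + x * q * (X * Q * T * d (suc k))
            ≈⟨ sym (+-cong (*-congʳ (*-congʳ (pow-* x q k))) (*-congˡ (*-congʳ (*-congʳ (pow-* x q k))))) ⟩
          G k + x * q * H k ∎
          where
            X = pow x k
            Q = pow q k
            T = pow q (tri k)

    tailPoch-suc-length : ∀ x m n → tailPoch x m (suc n) ≈ (1# + x * q * pow q m) * tailPoch (x * q) m n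
    tailPoch-suc-length x m n = trans (poch-suc-front _ q n)
      (*-cong (+-congˡ (trans (-‿involutive _) (sym (*-assoc x q (pow q m)))))
              (poch-cong q n (trans (sym (-‿distribˡ-* _ q)) (-‿cong (solve 3 (λ x Q q → x :* Q :* q := x :* q :* Q) refl x (pow q (suc m)) q)))))

    tailPoch-suc-index : ∀ x m n → tailPoch x (suc m) n ≈ tailPoch (x * q) m n
    tailPoch-suc-index x m n = poch-cong q n (-‿cong (sym (*-assoc x q (pow q (suc m)))))

    pochTriSum-suc : ∀ N x c →
      pochTriSum (suc N) x c ≈ pochTriSum N (x * q) c + x * q * pochTriSum N (x * q) (qShift c)
    pochTriSum-suc N x c = begin
      pochTriSum (suc N) x c
        ≈⟨ sumTo-binom-suc N F ⟩
      sumTo N (λ m → qShift F m * binom N m)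
        ≈⟨ sumTo-cong N (λ m m≤N → *-congʳ (term m m≤N)) ⟩
      sumTo N (λ m → (G m + x * q * H m) * binom N m)
        ≈⟨ sumTo-split N (x * q) G H (binom N) ⟩
      pochTriSum N (x * q) c + x * q * pochTriSum N (x * q) (qShift c) ∎
      where
        F G H : ℕ → Carrier
        F m = pow x m * pow q (tri m) * tailPoch x m (suc N ∸ m) * c m
        G m = pow (x * q) m * pow q (tri m) * tailPoch (x * q) m (N ∸ m) * c m
        H m = pow (x * q) m * pow q (tri m) * tailPoch (x * q) m (N ∸ m) * qShift c m
        term : ∀ m → m ≤ N → qShift F m ≈ G m + x * q * H m
        term m m≤N = begin
          Q * (X * T * tailPoch x m (suc N ∸ m) * c m) + x * X * pow q (tri (suc m)) * tailPoch x (suc m) (N ∸ m) * c (suc m)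
            ≈⟨ +-cong (*-congˡ (*-congʳ (*-congˡ (trans (reflexive (≡.cong (tailPoch x m) (ℕₚ.+-∸-assoc 1 m≤N)))
                                                          (tailPoch-suc-length x m (N ∸ m))))))
                      (*-cong (*-cong (*-congˡ (pow-tri-suc q m)) (tailPoch-suc-index x m (N ∸ m))) refl) ⟩
          Q * (X * T * ((1# + x * q * Q) * Π) * c m) + x * X * (q * Q * T) * Π * c (suc m)
            ≈⟨ solve 8 (λ x q X Q T Π c c′ → Q :* (X :* T :* ((con 1 :+ x :* q :* Q) :* Π) :* c) :+ x :* X :* (q :* Q :* T) :* Π :* c′
                         := X :* Q :* T :* Π :* c :+ x :* q :* (X :* Q :* T :* Π :* (Q :* c :+ c′)))
                       refl x q X Q T Π (c m) (c (suc m)) ⟩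
          X * Q * T * Π * c m + x * q * (X * Q * T * Π * qShift c m)
            ≈⟨ sym (+-cong (*-congʳ (*-congʳ (*-congʳ (pow-* x q m)))) (*-congˡ (*-congʳ (*-congʳ (*-congʳ (pow-* x q m)))))) ⟩
          G m + x * q * H m ∎
          where
            X = pow x m
            Q = pow q m
            T = pow q (tri m)
            Π = tailPoch (x * q) m (N ∸ m)

    triSum-binomialTransform : ∀ N x c → triSum N x (binomialTransform c) ≈ pochTriSum N x c
    triSum-binomialTransform zero x c =
      *-cong (trans (*-congˡ (trans (*-congˡ (binom-0 0)) (*-identityʳ _))) (sym (*-congʳ (*-identityʳ _)))) refl
    triSum-binomialTransform (suc N) x c = begin
      triSum (suc N) x (binomialTransform c)
        ≈⟨ triSum-suc N x _ ⟩
      triSum N (x * q) (binomialTransform c) + x * q * triSum N (x * q) (binomialTransform c ∘ suc)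
        ≈⟨ +-congˡ (*-congˡ (triSum-cong N (x * q) (λ k → sumTo-binom-suc k c))) ⟩
      triSum N (x * q) (binomialTransform c) + x * q * triSum N (x * q) (binomialTransform (qShift c))
        ≈⟨ +-cong (triSum-binomialTransform N (x * q) c) (*-congˡ (triSum-binomialTransform N (x * q) (qShift c))) ⟩
      pochTriSum N (x * q) c + x * q * pochTriSum N (x * q) (qShift c)
        ≈⟨ sym (pochTriSum-suc N x c) ⟩
      pochTriSum (suc N) x c ∎

theorem7 : {c ℓ : Level} (R : CommutativeRing c ℓ) →
    let open CommutativeRing R in
    let open QSeries R in
    (q a b t : Carrier) →
    (iq : ℕ → Carrier) → (∀ i → (1# + - pow q (suc i)) * iq i ≈ 1#) →
    (ia : ℕ → Carrier) → (∀ i → (1# + - (a * t * pow q (suc i))) * ia i ≈ 1#) →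
    (N : ℕ) →
    sumTo N (λ k → pow (b * t) k * pow q (tri k) * prod k ia * qbinom q iq N k)
      ≈ sumTo N (λ m → pow (b * t) m * pow q (tri m)
                         * poch (- (b * t * pow q (suc m))) q (N ∸ m)
                         * pow (a * t) m * pow q (m Data.Nat.* m)
                         * prod m ia * qbinom q iq N m)
theorem7 R q a b t iq hq ia ha N = begin
  triSum N (b * t) (λ k → prod k ia)
    ≈⟨ triSum-cong N (b * t) (λ k → sym (binomialTransform-squareTerm k (a * t) ia ha)) ⟩
  triSum N (b * t) (binomialTransform (squareTerm (a * t) ia))
    ≈⟨ triSum-binomialTransform N (b * t) _ ⟩
  pochTriSum N (b * t) (squareTerm (a * t) ia)
    ≈⟨ sumTo-cong N (λ m _ → *-congʳ (trans (sym (*-assoc _ _ _)) (*-congʳ (sym (*-assoc _ _ _))))) ⟩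
  sumTo N (λ m → pow (b * t) m * pow q (tri m) * tailPoch (b * t) m (N ∸ m)
                   * pow (a * t) m * pow q (m ℕ.* m) * prod m ia * binom N m) ∎
  where
    open CommutativeRing R
    open QSeries R
    open Properties R
    open Gaussian q iq hq
    open import Relation.Binary.Reasoning.Setoid setoid
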